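{- Let $G$ be a finite connected simple undirected graph on $n$ vertices with two distinct distinguished vertices $\mathbf{v}_{\mathrm{in}}$ and $\mathbf{v}_{\mathrm{out}}$, such that the graph $G\setminus\mathbf{v}_{\mathrm{out}}$ obtained by deleting $\mathbf{v}_{\mathrm{out}}$ is connected. Let $\mathcal{H}\subseteq\mathbb{R}^{V(G)}$ be the affine hull (minimal affine subspace) containing all traces $\mathrm{tr}_\omega$ of proper walks $\omega$. Then $\dim(\mathcal{H})=n-1$ if $G$ is not bipartite, and $\dim(\mathcal{H})=n-2$ if $G$ is bipartite.
   Context: A proper walk is a sequence $\omega=(v_0,v_1,\ldots,v_T)$ of vertices of $G$ with $v_0=\mathbf{v}_{\mathrm{in}}$, $v_T=\mathbf{v}_{\mathrm{out}}$, $v_{j}$ adjacent to $v_{j+1}$ for all $j$, and $v_j\neq\mathbf{v}_{\mathrm{out}}$ for $j<T$. Its trace is the vector $\mathrm{tr}_\omega\in\mathbb{R}^{V(G)}$ with $\mathrm{tr}_\omega(x)=|\{j:0\le j\le T,\ v_j=x\}|$. -}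

module Defs where

open import Data.Nat using (ℕ; zero; suc)
open import Data.Fin using (Fin; zero; suc)
open import Data.Bool using (Bool; true; false)
open import Data.Product using (Σ; _×_; _,_; ∃)
open import Data.Rational using (ℚ; 0ℚ; 1ℚ; _+_; _*_)
open import Relation.Binary.PropositionalEquality using (_≡_; _≢_)
open import Relation.Nullary using (¬_; Dec; yes; no)
open import Data.Fin using (_≟_)

record Graph (n : ℕ) : Set where
  field
    adj   : Fin n → Fin n → Bool
    sym   : ∀ u v → adj u v ≡ adj v u
    irrefl : ∀ u → adj u u ≡ false

open Graph public

Adj : ∀ {n} → Graph n → Fin n → Fin n → Set
Adj G u v = adj G u v ≡ true

data Walk {n} (G : Graph n) : Fin n → Fin n → Set where
  here : ∀ {u} → Walk G u u
  step : ∀ {u w v} → Adj G u w → Walk G w v → Walk G u v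

data WalkAvoid {n} (G : Graph n) (x : Fin n) : Fin n → Fin n → Set where
  here : ∀ {u} → u ≢ x → WalkAvoid G x u u
  step : ∀ {u w v} → u ≢ x → Adj G u w → WalkAvoid G x w v → WalkAvoid G x u v

Connected : ∀ {n} → Graph n → Set
Connected G = ∀ u v → Walk G u v

ConnectedWithout : ∀ {n} → Graph n → Fin n → Set
ConnectedWithout G x = ∀ u v → u ≢ x → v ≢ x → WalkAvoid G x u v

Bipartite : ∀ {n} → Graph n → Set
Bipartite {n} G = Σ (Fin n → Bool) λ c → ∀ u v → Adj G u v → c u ≢ c v

-- Proper walks from u to vout: end at vout and do not visit vout before the end.
data PWalk {n} (G : Graph n) (vout : Fin n) : Fin n → Set where
  stop : PWalk G vout vout
  step : ∀ {u w} → u ≢ vout → Adj G u w → PWalk G vout w → PWalk G vout u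

δ : ∀ {n} → Fin n → Fin n → ℚ
δ u x with u ≟ x
... | yes _ = 1ℚ
... | no _  = 0ℚ

trace : ∀ {n} {G : Graph n} {vout u : Fin n} → PWalk G vout u → Fin n → ℚ
trace {vout = vout} stop x = δ vout x
trace (step {u = u} _ _ ω) x = δ u x + trace ω x

Σℚ : ∀ k → (Fin k → ℚ) → ℚ
Σℚ zero f = 0ℚ
Σℚ (suc k) f = f zero + Σℚ k (λ i → f (suc i))

AffinelyIndependent : ∀ {n} k → (Fin k → Fin n → ℚ) → Set
AffinelyIndependent {n} k p =
  (λ' : Fin k → ℚ) → Σℚ k λ' ≡ 0ℚ →
  (∀ x → Σℚ k (λ i → λ' i * p i x) ≡ 0ℚ) → ∀ i → λ' i ≡ 0ℚ

AffHullDim : ∀ {n} {A : Set} → (A → Fin n → ℚ) → ℕ → Set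
AffHullDim {A = A} f d =
  (Σ (Fin (suc d) → A) λ a → AffinelyIndependent (suc d) (λ i → f (a i)))
  × ((a : Fin (suc (suc d)) → A) → ¬ AffinelyIndependent (suc (suc d)) (λ i → f (a i)))

traces : ∀ {n} (G : Graph n) (vin vout : Fin n) → PWalk G vout vin → Fin n → ℚ
traces G vin vout ω = trace ω

-- Lift every trace t to (1, t) ∈ ℚ^(n+1), so that affine independence of traces becomes linear
-- independence of the lifts. Every lift is annihilated by (-1, δ vout), since a proper walk visits
-- vout exactly once, and, when G is bipartite with colour signs s = ±1, by (-(s vin + s vout)/2, s),
-- since the signs alternate along a walk. Deleting one coordinate per functional bounds the
-- dimension from above.
--
-- For the lower bound take a finite family of probe walks and an annihilator (c, a) of their lifts.
-- Two probes that differ by a back-and-forth step along an edge xw of G - vout give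
-- a x + a w = 0, so away from vout the value of a is ±(a vin), and probes leaving through
-- different neighbours of vout show that a is constant on those neighbours. If a vin ≠ 0 the sign
-- of a is then a proper 2-colouring of G (with vout opposite to its neighbours). Hence the
-- annihilator of the probes is spanned by the functionals above, and Gaussian elimination
-- (rank + nullity = n + 1) extracts n, respectively n - 1, linearly independent probe lifts.

module Submission where

open import Defs hiding (sym)
open import Function using (_∘_; Injective)
open import Data.Nat as ℕ using (ℕ; zero; suc; _∸_; _≤_)
import Data.Nat.Properties as ℕ
open import Data.Fin as Fin using (Fin; zero; suc; punchIn; punchOut)
open import Data.Fin.Properties using (any?; injective⇒≤; punchIn-punchOut; punchInᵢ≢i)
open import Data.Vec.Functional using (Vector; _∷_; []; tail; removeAt)
open import Data.Bool as Bool using (Bool; true; false)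
import Data.Bool.Properties as Bool
open import Data.Rational using (ℚ; 0ℚ; 1ℚ; ½; _+_; _*_; -_; _-_; 1/_; ≢-nonZero)
open import Data.Rational.Properties
  using ( _≟_; +-*-commutativeRing; +-identityˡ; +-identityʳ; +-assoc; neg-injective
        ; *-identityˡ; *-identityʳ; *-zeroˡ; *-zeroʳ; *-assoc; *-comm; *-distribˡ-+; *-distribʳ-+
        ; *-inverseˡ; *-inverseʳ )
open import Data.Rational.Solver using (module +-*-Solver)
open import Algebra.Bundles using (CommutativeRing)
open import Algebra.Properties.Semiring.Sum (CommutativeRing.semiring +-*-commutativeRing)
  using (sum; sum-cong-≗; sum-replicate-zero; sum-remove; ∑-comm; ∑-distrib-+; *-distribˡ-sum; *-distribʳ-sum)
open import Data.Product using (Σ; ∃; _×_; _,_; proj₁; proj₂)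
open import Data.Sum using (_⊎_; inj₁; inj₂; [_,_]′)
open import Relation.Unary using (Decidable)
open import Relation.Nullary using (¬_; Dec; yes; no)
open import Relation.Nullary.Decidable using (¬?; decidable-stable; isYes)
open import Relation.Nullary.Negation using (contradiction)
open import Relation.Binary.PropositionalEquality
open ≡-Reasoning
open +-*-Solver using (solve; _:=_; _:+_; _:-_; :-_; _:*_; con)

private
  variable
    k m N : ℕ

halve : ∀ {p} → p + p ≡ 0ℚ → p ≡ 0ℚ
halve {p} p+p≡0 = begin
  p            ≡⟨ solve 1 (λ p → p := con ½ :* (p :+ p)) refl p ⟩
  ½ * (p + p)  ≡⟨ cong (½ *_) p+p≡0 ⟩
  0ℚ           ∎

*-cancelʳ-≢0 : ∀ {p q} → q ≢ 0ℚ → p * q ≡ 0ℚ → p ≡ 0ℚ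
*-cancelʳ-≢0 {p} {q} q≢0 pq≡0 = begin
  p               ≡⟨ *-identityʳ p ⟨
  p * 1ℚ          ≡⟨ cong (p *_) (*-inverseʳ q) ⟨
  p * (q * 1/ q)  ≡⟨ *-assoc p q (1/ q) ⟨
  p * q * 1/ q    ≡⟨ cong (_* 1/ q) pq≡0 ⟩
  0ℚ * 1/ q       ≡⟨ *-zeroˡ (1/ q) ⟩
  0ℚ              ∎
  where instance _ = ≢-nonZero q≢0

infix 7 _·_

_·_ : Vector ℚ N → Vector ℚ N → ℚ
x · y = sum (λ t → x t * y t)

combination : Vector ℚ k → (Fin k → Vector ℚ N) → Vector ℚ N
combination c v t = c · λ i → v i t

Independent : (Fin k → Vector ℚ N) → Set
Independent v = ∀ c → (∀ t → combination c v t ≡ 0ℚ) → ∀ i → c i ≡ 0ℚ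

_∈Span_ : Vector ℚ N → (Fin m → Vector ℚ N) → Set
v ∈Span b = ∃ λ z → ∀ t → v t ≡ combination z b t

·-congʳ : (x : Vector ℚ N) {y z : Vector ℚ N} → (∀ t → y t ≡ z t) → x · y ≡ x · z
·-congʳ x y≗z = sum-cong-≗ (λ t → cong (x t *_) (y≗z t))

·-comm : (x y : Vector ℚ N) → x · y ≡ y · x
·-comm x y = sum-cong-≗ (λ t → *-comm (x t) (y t))

·-distribʳ-+ : (x y z : Vector ℚ N) → x · (λ t → y t + z t) ≡ x · y + x · z
·-distribʳ-+ x y z =
  trans (sum-cong-≗ (λ t → *-distribˡ-+ (x t) (y t) (z t))) (∑-distrib-+ (λ t → x t * y t) (λ t → x t * z t))

·-*ʳ : (x y : Vector ℚ N) (q : ℚ) → x · (λ t → y t * q) ≡ (x · y) * q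
·-*ʳ x y q = begin
  x · (λ t → y t * q)          ≡⟨ sum-cong-≗ (λ t → *-assoc (x t) (y t) q) ⟨
  sum (λ t → x t * y t * q)    ≡⟨ *-distribʳ-sum q (λ t → x t * y t) ⟨
  (x · y) * q                  ∎

·-zeroʳ : (x : Vector ℚ N) {y : Vector ℚ N} → (∀ t → y t ≡ 0ℚ) → x · y ≡ 0ℚ
·-zeroʳ {N} x y≗0 =
  trans (sum-cong-≗ (λ t → trans (cong (x t *_) (y≗0 t)) (*-zeroʳ (x t)))) (sum-replicate-zero N)

·-zeroˡ : {x : Vector ℚ N} (y : Vector ℚ N) → (∀ t → x t ≡ 0ℚ) → x · y ≡ 0ℚ
·-zeroˡ {x = x} y x≗0 = trans (·-comm x y) (·-zeroʳ y x≗0)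

δ-self : (u : Fin N) → δ u u ≡ 1ℚ
δ-self u with u Fin.≟ u
... | yes _   = refl
... | no u≢u = contradiction refl u≢u

δ-≢ : {u x : Fin N} → u ≢ x → δ u x ≡ 0ℚ
δ-≢ {u = u} {x} u≢x with u Fin.≟ x
... | yes u≡x = contradiction u≡x u≢x
... | no _    = refl

·-δ : (x : Vector ℚ N) (u : Fin N) → x · δ u ≡ x u
·-δ {suc N} x u = begin
  x · δ u
    ≡⟨ sum-remove {i = u} (λ t → x t * δ u t) ⟩
  x u * δ u u + sum (λ j → x (punchIn u j) * δ u (punchIn u j))
    ≡⟨ cong₂ _+_ (cong (x u *_) (δ-self u)) (·-zeroʳ (x ∘ punchIn u) (λ j → δ-≢ (punchInᵢ≢i u j ∘ sym))) ⟩
  x u * 1ℚ + 0ℚ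
    ≡⟨ solve 1 (λ a → a :* con 1ℚ :+ con 0ℚ := a) refl (x u) ⟩
  x u ∎

·-removeAt : {ℓ u : Vector ℚ (suc N)} {p : Fin (suc N)} → ℓ p ≡ 0ℚ → removeAt ℓ p · removeAt u p ≡ ℓ · u
·-removeAt {ℓ = ℓ} {u} {p} ℓp≡0 = begin
  removeAt ℓ p · removeAt u p
    ≡⟨ +-identityˡ _ ⟨
  0ℚ + removeAt ℓ p · removeAt u p
    ≡⟨ cong (_+ removeAt ℓ p · removeAt u p) (trans (cong (_* u p) ℓp≡0) (*-zeroˡ (u p))) ⟨
  ℓ p * u p + removeAt ℓ p · removeAt u p
    ≡⟨ sum-remove {i = p} (λ t → ℓ t * u t) ⟨
  ℓ · u ∎

·-combination : (c : Vector ℚ k) (v : Fin k → Vector ℚ N) (w : Vector ℚ N) →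
                c · (λ i → v i · w) ≡ combination c v · w
·-combination c v w = begin
  sum (λ i → c i * sum (λ t → v i t * w t))
    ≡⟨ sum-cong-≗ (λ i → *-distribˡ-sum (c i) (λ t → v i t * w t)) ⟩
  sum (λ i → sum (λ t → c i * (v i t * w t)))
    ≡⟨ ∑-comm (λ i t → c i * (v i t * w t)) ⟩
  sum (λ t → sum (λ i → c i * (v i t * w t)))
    ≡⟨ sum-cong-≗ (λ t → sum-cong-≗ (λ i → *-assoc (c i) (v i t) (w t))) ⟨
  sum (λ t → sum (λ i → c i * v i t * w t))
    ≡⟨ sum-cong-≗ (λ t → *-distribʳ-sum (w t) (λ i → c i * v i t)) ⟨
  combination c v · w ∎

independent-of-tails : {v : Fin k → Vector ℚ (suc N)} → Independent (tail ∘ v) → Independent v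
independent-of-tails independent c c·v≡0 = independent c (c·v≡0 ∘ suc)

independent-of-zeros : {v : Fin k → Vector ℚ N} → Independent v → (∀ i t → v i t ≡ 0ℚ) → k ≡ 0
independent-of-zeros {zero}  _           _   = refl
independent-of-zeros {suc k} independent v≡0 =
  contradiction (independent (λ _ → 1ℚ) (λ t → ·-zeroʳ (λ _ → 1ℚ) (λ i → v≡0 i t)) zero) λ ()

·-δ-difference : (a b : Fin k) (w : Vector ℚ k) → (λ i → δ a i - δ b i) · w ≡ w a - w b
·-δ-difference a b w = begin
  (λ i → δ a i - δ b i) · w
    ≡⟨ ·-comm _ w ⟩
  w · (λ i → δ a i - δ b i)
    ≡⟨ ·-congʳ w (λ i → solve 2 (λ p q → p :- q := p :+ q :* con (- 1ℚ)) refl (δ a i) (δ b i)) ⟩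
  w · (λ i → δ a i + δ b i * - 1ℚ)
    ≡⟨ ·-distribʳ-+ w (δ a) (λ i → δ b i * - 1ℚ) ⟩
  w · δ a + w · (λ i → δ b i * - 1ℚ)
    ≡⟨ cong₂ _+_ (·-δ w a) (trans (·-*ʳ w (δ b) (- 1ℚ)) (cong (_* - 1ℚ) (·-δ w b))) ⟩
  w a + w b * - 1ℚ
    ≡⟨ solve 2 (λ p q → p :+ q :* con (- 1ℚ) := p :- q) refl (w a) (w b) ⟩
  w a - w b ∎

independent⇒injective : ∀ {I : Set} {u : I → Vector ℚ N} {f : Fin k → I} →
                        Independent (u ∘ f) → Injective _≡_ _≡_ f
independent⇒injective {u = u} {f} independent {a} {b} fa≡fb with a Fin.≟ b
... | yes a≡b = a≡b
... | no a≢b  = contradiction (independent c c-annihilates a) c[a]≢0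
  where
  c : Vector ℚ _
  c i = δ a i - δ b i
  c-annihilates : ∀ t → combination c (u ∘ f) t ≡ 0ℚ
  c-annihilates t = begin
    c · (λ i → u (f i) t)   ≡⟨ ·-δ-difference a b (λ i → u (f i) t) ⟩
    u (f a) t - u (f b) t   ≡⟨ cong (λ j → u (f a) t - u j t) fa≡fb ⟨
    u (f a) t - u (f a) t   ≡⟨ solve 1 (λ p → p :- p := con 0ℚ) refl (u (f a) t) ⟩
    0ℚ                      ∎
  c[a]≢0 : c a ≢ 0ℚ
  c[a]≢0 c[a]≡0 = contradiction (trans (sym (cong₂ _-_ (δ-self a) (δ-≢ (a≢b ∘ sym)))) c[a]≡0) λ ()

Searchable : Set → Set₁
Searchable I = ∀ {P : I → Set} → Decidable P → Dec (∃ P)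

record RankDecomposition {I : Set} (u : I → Vector ℚ N) : Set where
  field
    rank nullity            : ℕ
    rank+nullity            : rank ℕ.+ nullity ≡ N
    basis                   : Fin rank → I
    basis-independent       : Independent (u ∘ basis)
    annihilator             : Fin nullity → Vector ℚ N
    annihilator-independent : Independent annihilator
    annihilates             : ∀ j i → annihilator j · u i ≡ 0ℚ

module ZeroColumn {I : Set} (u : I → Vector ℚ (suc N)) (u₀≡0 : ∀ i → u i zero ≡ 0ℚ)
                  (R : RankDecomposition (tail ∘ u)) where
  open RankDecomposition R

  annihilator′ : Fin (suc nullity) → Vector ℚ (suc N)
  annihilator′ zero    = 1ℚ ∷ λ _ → 0ℚ
  annihilator′ (suc j) = 0ℚ ∷ annihilator j

  annihilates′ : ∀ j i → annihilator′ j · u i ≡ 0ℚ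
  annihilates′ zero    i =
    cong₂ _+_ (cong (1ℚ *_) (u₀≡0 i)) (·-zeroˡ (tail (u i)) (λ _ → refl))
  annihilates′ (suc j) i =
    cong₂ _+_ (*-zeroˡ (u i zero)) (annihilates j i)

  annihilator′-independent : Independent annihilator′
  annihilator′-independent c c·y≡0 zero = begin
    c zero                             ≡⟨ solve 1 (λ p → p := p :* con 1ℚ :+ con 0ℚ) refl (c zero) ⟩
    c zero * 1ℚ + 0ℚ                   ≡⟨ cong (c zero * 1ℚ +_) (·-zeroʳ (tail c) (λ _ → refl)) ⟨
    c zero * 1ℚ + tail c · (λ _ → 0ℚ)  ≡⟨ c·y≡0 zero ⟩
    0ℚ                                 ∎
  annihilator′-independent c c·y≡0 (suc j) = annihilator-independent (tail c) tail-annihilates j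
    where
    tail-annihilates : ∀ t → combination (tail c) annihilator t ≡ 0ℚ
    tail-annihilates t = begin
      combination (tail c) annihilator t
        ≡⟨ solve 2 (λ p q → q := p :* con 0ℚ :+ q) refl (c zero) (combination (tail c) annihilator t) ⟩
      c zero * 0ℚ + combination (tail c) annihilator t
        ≡⟨ c·y≡0 (suc t) ⟩
      0ℚ ∎

  extend : RankDecomposition u
  extend = record
    { rank                    = rank
    ; nullity                 = suc nullity
    ; rank+nullity            = trans (ℕ.+-suc rank nullity) (cong suc rank+nullity)
    ; basis                   = basis
    ; basis-independent       = independent-of-tails basis-independent
    ; annihilator             = annihilator′
    ; annihilator-independent = annihilator′-independent
    ; annihilates             = annihilates′
    }

module Pivot {I : Set} (u : I → Vector ℚ (suc N)) (p : I) (π≢0 : u p zero ≢ 0ℚ) where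
  private instance _ = ≢-nonZero π≢0

  π : ℚ
  π = u p zero

  ratio : I → ℚ
  ratio i = u i zero * 1/ π

  ratio-*-π : ∀ i → ratio i * π ≡ u i zero
  ratio-*-π i = begin
    u i zero * 1/ π * π    ≡⟨ *-assoc (u i zero) (1/ π) π ⟩
    u i zero * (1/ π * π)  ≡⟨ cong (u i zero *_) (*-inverseˡ π) ⟩
    u i zero * 1ℚ          ≡⟨ *-identityʳ (u i zero) ⟩
    u i zero               ∎

  reduced : I → Vector ℚ N
  reduced i t = u i (suc t) - ratio i * u p (suc t)

  ·-reduced : (x : Vector ℚ k) (f : Fin k → I) (t : Fin N) →
              x · (λ j → reduced (f j) t) ≡ x · (λ j → u (f j) (suc t)) - (x · (ratio ∘ f)) * u p (suc t)
  ·-reduced x f t = begin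
    x · (λ j → reduced (f j) t)
      ≡⟨ ·-congʳ x (λ j → solve 3 (λ a r z → a :- r :* z := a :+ r :* (:- z)) refl
                                  (u (f j) (suc t)) (ratio (f j)) (u p (suc t))) ⟩
    x · (λ j → u (f j) (suc t) + ratio (f j) * - u p (suc t))
      ≡⟨ ·-distribʳ-+ x (λ j → u (f j) (suc t)) (λ j → ratio (f j) * - u p (suc t)) ⟩
    x · (λ j → u (f j) (suc t)) + x · (λ j → ratio (f j) * - u p (suc t))
      ≡⟨ cong (x · (λ j → u (f j) (suc t)) +_) (·-*ʳ x (ratio ∘ f) (- u p (suc t))) ⟩
    x · (λ j → u (f j) (suc t)) + (x · (ratio ∘ f)) * - u p (suc t)
      ≡⟨ solve 3 (λ a s z → a :+ s :* (:- z) := a :- s :* z) refl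
                 (x · (λ j → u (f j) (suc t))) (x · (ratio ∘ f)) (u p (suc t)) ⟩
    x · (λ j → u (f j) (suc t)) - (x · (ratio ∘ f)) * u p (suc t) ∎

  module _ (R : RankDecomposition reduced) where
    open RankDecomposition R

    basis′ : Fin (suc rank) → I
    basis′ = p ∷ basis

    basis′-independent : Independent (u ∘ basis′)
    basis′-independent c c·u≡0 = λ { zero → c₀≡0 ; (suc j) → tail-c≡0 j }
      where
      S : ℚ
      S = tail c · (ratio ∘ basis)
      c₀+S≡0 : c zero + S ≡ 0ℚ
      c₀+S≡0 = *-cancelʳ-≢0 π≢0 (begin
        (c zero + S) * π
          ≡⟨ *-distribʳ-+ π (c zero) S ⟩
        c zero * π + S * π
          ≡⟨ cong (c zero * π +_) (·-*ʳ (tail c) (ratio ∘ basis) π) ⟨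
        c zero * π + tail c · (λ j → ratio (basis j) * π)
          ≡⟨ cong (c zero * π +_) (·-congʳ (tail c) (ratio-*-π ∘ basis)) ⟩
        combination c (u ∘ basis′) zero
          ≡⟨ c·u≡0 zero ⟩
        0ℚ ∎)
      tail-c≡0 : ∀ j → tail c j ≡ 0ℚ
      tail-c≡0 = basis-independent (tail c) λ t → begin
        tail c · (λ j → reduced (basis j) t)
          ≡⟨ ·-reduced (tail c) basis t ⟩
        tail c · (λ j → u (basis j) (suc t)) - S * u p (suc t)
          ≡⟨ solve 4 (λ a c₀ s z → a :- s :* z := (c₀ :* z :+ a) :- (c₀ :+ s) :* z) refl
                     (tail c · (λ j → u (basis j) (suc t))) (c zero) S (u p (suc t)) ⟩
        combination c (u ∘ basis′) (suc t) - (c zero + S) * u p (suc t)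
          ≡⟨ cong₂ (λ a s → a - s * u p (suc t)) (c·u≡0 (suc t)) c₀+S≡0 ⟩
        0ℚ - 0ℚ * u p (suc t)
          ≡⟨ solve 1 (λ z → con 0ℚ :- con 0ℚ :* z := con 0ℚ) refl (u p (suc t)) ⟩
        0ℚ ∎
      c₀≡0 : c zero ≡ 0ℚ
      c₀≡0 = begin
        c zero       ≡⟨ +-identityʳ (c zero) ⟨
        c zero + 0ℚ  ≡⟨ cong (c zero +_) (·-zeroˡ (ratio ∘ basis) tail-c≡0) ⟨
        c zero + S   ≡⟨ c₀+S≡0 ⟩
        0ℚ           ∎

    annihilator′ : Fin nullity → Vector ℚ (suc N)
    annihilator′ j = - ((annihilator j · tail (u p)) * 1/ π) ∷ annihilator j

    annihilates′ : ∀ j i → annihilator′ j · u i ≡ 0ℚ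
    annihilates′ j i = begin
      - (σ * 1/ π) * u i zero + y · tail (u i)
        ≡⟨ cong (- (σ * 1/ π) * u i zero +_) (·-congʳ y tail-u) ⟩
      - (σ * 1/ π) * u i zero + y · (λ t → reduced i t + u p (suc t) * ratio i)
        ≡⟨ cong (- (σ * 1/ π) * u i zero +_) (·-distribʳ-+ y (reduced i) (λ t → u p (suc t) * ratio i)) ⟩
      - (σ * 1/ π) * u i zero + (y · reduced i + y · (λ t → u p (suc t) * ratio i))
        ≡⟨ cong₂ (λ a b → - (σ * 1/ π) * u i zero + (a + b)) (annihilates j i) (·-*ʳ y (tail (u p)) (ratio i)) ⟩
      - (σ * 1/ π) * u i zero + (0ℚ + σ * (u i zero * 1/ π))
        ≡⟨ solve 3 (λ s e a → :- (s :* e) :* a :+ (con 0ℚ :+ s :* (a :* e)) := con 0ℚ) refl σ (1/ π) (u i zero) ⟩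
      0ℚ ∎
      where
      y = annihilator j
      σ = y · tail (u p)
      tail-u : ∀ t → u i (suc t) ≡ reduced i t + u p (suc t) * ratio i
      tail-u t = solve 3 (λ a r z → a := (a :- r :* z) :+ z :* r) refl (u i (suc t)) (ratio i) (u p (suc t))

    extend : RankDecomposition u
    extend = record
      { rank                    = suc rank
      ; nullity                 = nullity
      ; rank+nullity            = cong suc rank+nullity
      ; basis                   = basis′
      ; basis-independent       = basis′-independent
      ; annihilator             = annihilator′
      ; annihilator-independent = independent-of-tails annihilator-independent
      ; annihilates             = annihilates′
      }

rank-decomposition : ∀ {I : Set} → Searchable I → (u : I → Vector ℚ N) → RankDecomposition u
rank-decomposition {zero} _ _ = record
  { rank                    = 0
  ; nullity                 = 0
  ; rank+nullity            = refl
  ; basis                   = λ ()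
  ; basis-independent       = λ _ _ ()
  ; annihilator             = λ ()
  ; annihilator-independent = λ _ _ ()
  ; annihilates             = λ ()
  }
rank-decomposition {suc N} search u with search (λ i → ¬? (u i zero ≟ 0ℚ))
... | yes (p , π≢0) = Pivot.extend u p π≢0 (rank-decomposition search (Pivot.reduced u p π≢0))
... | no no-pivot   = ZeroColumn.extend u u₀≡0 (rank-decomposition search (tail ∘ u))
  where
  u₀≡0 : ∀ i → u i zero ≡ 0ℚ
  u₀≡0 i = decidable-stable (u i zero ≟ 0ℚ) (λ u₀≢0 → no-pivot (i , u₀≢0))

-- Decompose the family of columns of v: its annihilators are linear dependencies of v, so there
-- are none, and its basis is an injection of Fin k into the columns.
independent⇒≤ : {v : Fin k → Vector ℚ N} → Independent v → k ≤ N
independent⇒≤ {k} {N} {v} independent =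
  subst (_≤ N) rank≡k (injective⇒≤ (independent⇒injective {u = λ t i → v i t} basis-independent))
  where
  open RankDecomposition (rank-decomposition any? (λ t i → v i t))
  nullity≡0 : nullity ≡ 0
  nullity≡0 = independent-of-zeros annihilator-independent (λ j → independent (annihilator j) (annihilates j))
  rank≡k : rank ≡ k
  rank≡k = trans (sym (ℕ.+-identityʳ rank)) (trans (cong (rank ℕ.+_) (sym nullity≡0)) rank+nullity)

independent⇒≤span : {v : Fin k → Vector ℚ N} {b : Fin m → Vector ℚ N} →
                    Independent v → (∀ i → v i ∈Span b) → k ≤ m
independent⇒≤span {v = v} {b} independent v∈b = independent⇒≤ coefficients-independent
  where
  coefficients-independent : Independent (proj₁ ∘ v∈b)
  coefficients-independent c c·z≡0 = independent c λ t → begin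
    c · (λ i → v i t)                            ≡⟨ ·-congʳ c (λ i → proj₂ (v∈b i) t) ⟩
    c · (λ i → proj₁ (v∈b i) · (λ q → b q t))    ≡⟨ ·-combination c (proj₁ ∘ v∈b) (λ q → b q t) ⟩
    combination c (proj₁ ∘ v∈b) · (λ q → b q t)  ≡⟨ ·-zeroˡ (λ q → b q t) c·z≡0 ⟩
    0ℚ                                           ∎

independent-removeAt : {u : Fin k → Vector ℚ (suc N)} {ℓ : Vector ℚ (suc N)} (p : Fin (suc N)) →
                       ℓ p ≢ 0ℚ → (∀ i → ℓ · u i ≡ 0ℚ) → Independent u →
                       Independent (λ i → removeAt (u i) p)
independent-removeAt {u = u} {ℓ} p ℓp≢0 ℓ⊥u independent c c·u′≡0 = independent c c·u≡0
  where
  w : Vector ℚ _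
  w = combination c u
  w[p]≡0 : w p ≡ 0ℚ
  w[p]≡0 = *-cancelʳ-≢0 ℓp≢0 (begin
    w p * ℓ p                                ≡⟨ solve 2 (λ a b → a :* b := b :* a :+ con 0ℚ) refl (w p) (ℓ p) ⟩
    ℓ p * w p + 0ℚ                           ≡⟨ cong (ℓ p * w p +_) (·-zeroʳ (removeAt ℓ p) c·u′≡0) ⟨
    ℓ p * w p + removeAt ℓ p · removeAt w p  ≡⟨ sum-remove {i = p} (λ t → ℓ t * w t) ⟨
    ℓ · w                                    ≡⟨ ·-comm ℓ w ⟩
    combination c u · ℓ                      ≡⟨ ·-combination c u ℓ ⟨
    c · (λ i → u i · ℓ)                      ≡⟨ ·-zeroʳ c (λ i → trans (·-comm (u i) ℓ) (ℓ⊥u i)) ⟩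
    0ℚ                                       ∎)
  c·u≡0 : ∀ t → w t ≡ 0ℚ
  c·u≡0 t with p Fin.≟ t
  ... | yes refl = w[p]≡0
  ... | no p≢t   = subst (λ s → w s ≡ 0ℚ) (punchIn-punchOut p≢t) (c·u′≡0 (punchOut p≢t))

independent-suffix : ∀ e {v : Fin (e ℕ.+ k) → Vector ℚ N} → Independent v → Independent (v ∘ (e Fin.↑ʳ_))
independent-suffix zero    independent = independent
independent-suffix (suc e) {v} independent = independent-suffix e {v = v ∘ suc} λ c c·v≡0 i →
  independent (0ℚ ∷ c) (λ t → trans (cong (_+ c · (λ i → v (suc i) t)) (*-zeroˡ (v zero t)))
                                    (trans (+-identityˡ _) (c·v≡0 t))) (suc i)

independent-subfamily : ∀ {r} {v : Fin r → Vector ℚ N} → k ≤ r → Independent v →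
                        ∃ λ (f : Fin k → Fin r) → Independent (v ∘ f)
independent-subfamily {k = k} {r} k≤r independent with r ∸ k | ℕ.m∸n+n≡m k≤r
... | e | refl = (e Fin.↑ʳ_) , independent-suffix e independent

independent-of-small-annihilator :
  ∀ {I : Set} → Searchable I → (u : I → Vector ℚ N) (b : Fin m → Vector ℚ N) →
  (∀ y → (∀ i → y · u i ≡ 0ℚ) → y ∈Span b) → m ℕ.+ k ≡ N →
  ∃ λ (f : Fin k → I) → Independent (u ∘ f)
independent-of-small-annihilator {N} {m} {k} search u b annihilator∈b m+k≡N =
  let g , independent = independent-subfamily k≤rank basis-independent in basis ∘ g , independent
  where
  open RankDecomposition (rank-decomposition search u)
  nullity≤m : nullity ≤ m
  nullity≤m = independent⇒≤span annihilator-independent (λ j → annihilator∈b (annihilator j) (annihilates j))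
  k≤rank : k ≤ rank
  k≤rank = ℕ.+-cancelʳ-≤ m k rank
    (ℕ.≤-trans (ℕ.≤-reflexive (trans (ℕ.+-comm k m) (trans m+k≡N (sym rank+nullity))))
               (ℕ.+-monoʳ-≤ rank nullity≤m))

Σℚ≡sum : ∀ k (f : Vector ℚ k) → Σℚ k f ≡ sum f
Σℚ≡sum zero    f = refl
Σℚ≡sum (suc k) f = cong (f zero +_) (Σℚ≡sum k (f ∘ suc))

lift : Vector ℚ N → Vector ℚ (suc N)
lift p = 1ℚ ∷ p

module _ {p : Fin k → Vector ℚ N} where

  affinelyIndependent⇒independent : AffinelyIndependent k p → Independent (lift ∘ p)
  affinelyIndependent⇒independent independent c c·p≡0 =
    independent c (trans (Σℚ≡sum k c) (trans (sum-cong-≗ (λ i → sym (*-identityʳ (c i)))) (c·p≡0 zero)))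
                  (λ x → trans (Σℚ≡sum k (λ i → c i * p i x)) (c·p≡0 (suc x)))

  independent⇒affinelyIndependent : Independent (lift ∘ p) → AffinelyIndependent k p
  independent⇒affinelyIndependent independent c Σc≡0 Σcp≡0 = independent c λ
    { zero    → trans (sum-cong-≗ (λ i → *-identityʳ (c i))) (trans (sym (Σℚ≡sum k c)) Σc≡0)
    ; (suc x) → trans (sym (Σℚ≡sum k (λ i → c i * p i x))) (Σcp≡0 x)
    }

module Walks {n} (G : Graph n) (vout : Fin n) where

  adjacent-sym : ∀ {u v} → Adj G u v → Adj G v u
  adjacent-sym {u} {v} u~v = trans (Graph.sym G v u) u~v

  start≢ : ∀ {u v} → WalkAvoid G vout u v → u ≢ vout
  start≢ (here u≢vout)     = u≢vout
  start≢ (step u≢vout _ _) = u≢vout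

  infixr 5 _++_

  _++_ : ∀ {u v} → WalkAvoid G vout u v → PWalk G vout v → PWalk G vout u
  here _            ++ ω = ω
  step u≢vout u~w W ++ ω = step u≢vout u~w (W ++ ω)

  weight⁻ : Vector ℚ n → ∀ {u v} → WalkAvoid G vout u v → ℚ
  weight⁻ a (here _)             = 0ℚ
  weight⁻ a (step {u = u} _ _ W) = a u + weight⁻ a W

  ·-trace-step : ∀ (a : Vector ℚ n) {u w} (u≢vout : u ≢ vout) (u~w : Adj G u w) (ω : PWalk G vout w) →
                 a · trace (step u≢vout u~w ω) ≡ a u + a · trace ω
  ·-trace-step a {u} _ _ ω = trans (·-distribʳ-+ a (δ u) (trace ω)) (cong (_+ a · trace ω) (·-δ a u))

  ·-trace-++ : ∀ (a : Vector ℚ n) {u v} (W : WalkAvoid G vout u v) (ω : PWalk G vout v) →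
               a · trace (W ++ ω) ≡ weight⁻ a W + a · trace ω
  ·-trace-++ a (here _)                    ω = sym (+-identityˡ (a · trace ω))
  ·-trace-++ a (step {u = u} u≢vout u~w W) ω = begin
    a · trace (step u≢vout u~w (W ++ ω))  ≡⟨ ·-trace-step a u≢vout u~w (W ++ ω) ⟩
    a u + a · trace (W ++ ω)              ≡⟨ cong (a u +_) (·-trace-++ a W ω) ⟩
    a u + (weight⁻ a W + a · trace ω)     ≡⟨ +-assoc (a u) (weight⁻ a W) (a · trace ω) ⟨
    a u + weight⁻ a W + a · trace ω       ∎

  trace-vout : ∀ {u} (ω : PWalk G vout u) → trace ω vout ≡ 1ℚ
  trace-vout stop              = δ-self vout
  trace-vout (step u≢vout _ ω) = trans (cong₂ _+_ (δ-≢ u≢vout) (trace-vout ω)) (+-identityˡ 1ℚ)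

  vout-functional : Vector ℚ (suc n)
  vout-functional = - 1ℚ ∷ δ vout

  vout-functional⊥ : ∀ {u} (ω : PWalk G vout u) → vout-functional · lift (trace ω) ≡ 0ℚ
  vout-functional⊥ ω = begin
    - 1ℚ * 1ℚ + δ vout · trace ω
      ≡⟨ cong (- 1ℚ * 1ℚ +_) (trans (·-comm (δ vout) (trace ω)) (·-δ (trace ω) vout)) ⟩
    - 1ℚ * 1ℚ + trace ω vout
      ≡⟨ cong (- 1ℚ * 1ℚ +_) (trace-vout ω) ⟩
    0ℚ ∎

  neighbour-of-vout : ∀ {u} → Walk G u vout → u ≢ vout → ∃ λ z → z ≢ vout × Adj G z vout
  neighbour-of-vout here                         u≢vout = contradiction refl u≢vout
  neighbour-of-vout (step {u = u} {w = w} u~w W) u≢vout with w Fin.≟ vout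
  ... | yes refl  = u , u≢vout , u~w
  ... | no w≢vout = neighbour-of-vout W w≢vout

sign : Bool → ℚ
sign true  = 1ℚ
sign false = - 1ℚ

sign≢0 : ∀ b → sign b ≢ 0ℚ
sign≢0 true  ()
sign≢0 false ()

sign²≡1 : ∀ b → sign b * sign b ≡ 1ℚ
sign²≡1 true  = refl
sign²≡1 false = refl

sign-flip : ∀ {b b′} → b ≢ b′ → sign b′ ≡ - sign b
sign-flip {true}  {true}  b≢b′ = contradiction refl b≢b′
sign-flip {false} {false} b≢b′ = contradiction refl b≢b′
sign-flip {true}  {false} _    = refl
sign-flip {false} {true}  _    = refl

module Signs {n} (G : Graph n) (vout : Fin n) (col : Fin n → Bool)
             (proper : ∀ u v → Adj G u v → col u ≢ col v) where

  s : Vector ℚ n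
  s = sign ∘ col

  s-alternates : ∀ {u w} → Adj G u w → s w ≡ - s u
  s-alternates {u} {w} u~w = sign-flip (proper u w u~w)

  s·trace : ∀ {u} (ω : PWalk G vout u) → s · trace ω ≡ ½ * (s u + s vout)
  s·trace stop = trans (·-δ s vout) (solve 1 (λ x → x := con ½ :* (x :+ x)) refl (s vout))
  s·trace (step {u = u} {w} u≢vout u~w ω) = begin
    s · trace (step u≢vout u~w ω)  ≡⟨ Walks.·-trace-step G vout s u≢vout u~w ω ⟩
    s u + s · trace ω              ≡⟨ cong (s u +_) (s·trace ω) ⟩
    s u + ½ * (s w + s vout)       ≡⟨ cong (λ x → s u + ½ * (x + s vout)) (s-alternates u~w) ⟩
    s u + ½ * (- s u + s vout)     ≡⟨ solve 2 (λ x y → x :+ con ½ :* (:- x :+ y) := con ½ :* (x :+ y)) refl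
                                              (s u) (s vout) ⟩
    ½ * (s u + s vout)             ∎

  sign-functional : Fin n → Vector ℚ (suc n)
  sign-functional u = - (½ * (s u + s vout)) ∷ s

  sign-functional⊥ : ∀ {u} (ω : PWalk G vout u) → sign-functional u · lift (trace ω) ≡ 0ℚ
  sign-functional⊥ {u} ω = begin
    - C * 1ℚ + s · trace ω  ≡⟨ cong (- C * 1ℚ +_) (s·trace ω) ⟩
    - C * 1ℚ + C            ≡⟨ solve 1 (λ x → :- x :* con 1ℚ :+ x := con 0ℚ) refl C ⟩
    0ℚ                      ∎
    where
    C = ½ * (s u + s vout)

affinelyIndependent-traces⇒≤ : ∀ {n} (G : Graph n) {vin vout} {ω : Fin k → PWalk G vout vin} →
                               AffinelyIndependent k (trace ∘ ω) → k ≤ n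
affinelyIndependent-traces⇒≤ G {vout = vout} {ω} independent =
  independent⇒≤ (independent-removeAt {ℓ = vout-functional} zero (λ ()) (vout-functional⊥ ∘ ω)
                                      (affinelyIndependent⇒independent {p = trace ∘ ω} independent))
  where open Walks G vout

-- First delete the coordinate of vin with the sign functional, then the constant coordinate with
-- the vout functional, which vanishes at vin.
bipartite-affinelyIndependent-traces⇒≤ :
  ∀ {n} (G : Graph (suc n)) {vin vout} → vin ≢ vout → Bipartite G →
  {ω : Fin k → PWalk G vout vin} → AffinelyIndependent k (trace ∘ ω) → k ≤ n
bipartite-affinelyIndependent-traces⇒≤ G {vin} {vout} vin≢vout (col , proper) {ω} independent =
  independent⇒≤ (independent-removeAt {ℓ = removeAt vout-functional (suc vin)} zero (λ ()) vout-functional′⊥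
                   (independent-removeAt {ℓ = sign-functional vin} (suc vin) (sign≢0 (col vin))
                                         (sign-functional⊥ ∘ ω)
                                         (affinelyIndependent⇒independent {p = trace ∘ ω} independent)))
  where
  open Walks G vout
  open Signs G vout col proper
  vout-functional′⊥ : ∀ i → removeAt vout-functional (suc vin) · removeAt (lift (trace (ω i))) (suc vin) ≡ 0ℚ
  vout-functional′⊥ i =
    trans (·-removeAt {ℓ = vout-functional} {u = lift (trace (ω i))} (δ-≢ (vin≢vout ∘ sym))) (vout-functional⊥ (ω i))

data Probe (n : ℕ) : Set where
  loop      : Fin n → Probe n
  excursion : Fin n → Fin n → Probe n

searchable-Probe : ∀ {n} → Searchable (Probe n)
searchable-Probe P? with any? (P? ∘ loop) | any? (λ x → any? (P? ∘ excursion x))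
... | yes (x , Px) | _                 = yes (loop x , Px)
... | no _         | yes (x , w , Pxw) = yes (excursion x w , Pxw)
... | no ¬loop     | no ¬excursion     = no λ
  { (loop x , Px)          → ¬loop (x , Px)
  ; (excursion x w , Pxw) → ¬excursion (x , w , Pxw)
  }

module Probes {n} (G : Graph n) {vin vout : Fin n} (vin≢vout : vin ≢ vout)
              (G-vout-connected : ConnectedWithout G vout)
              {z₀ : Fin n} (z₀≢vout : z₀ ≢ vout) (z₀~vout : Adj G z₀ vout) where
  open Walks G vout

  path-to : ∀ {x} → x ≢ vout → WalkAvoid G vout vin x
  path-to x≢vout = G-vout-connected _ _ vin≢vout x≢vout

  path-from : ∀ {x} → x ≢ vout → WalkAvoid G vout x vin
  path-from x≢vout = G-vout-connected _ _ x≢vout vin≢vout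

  base : PWalk G vout vin
  base = path-to z₀≢vout ++ step z₀≢vout z₀~vout stop

  adjacent? : ∀ x w → Dec (Adj G x w)
  adjacent? x w = adj G x w Bool.≟ true

  -- Indices that describe no walk (x = vout, or x and w not adjacent) give the base walk.
  walk : Probe n → PWalk G vout vin
  walk (loop x) with x Fin.≟ vout
  ... | yes _     = base
  ... | no x≢vout = path-to x≢vout ++ path-from x≢vout ++ base
  walk (excursion x w) with x Fin.≟ vout | w Fin.≟ vout | adjacent? x w
  ... | no x≢vout | yes refl  | yes x~w = path-to x≢vout ++ step x≢vout x~w stop
  ... | no x≢vout | no w≢vout | yes x~w =
    path-to x≢vout ++ step x≢vout x~w (step w≢vout (adjacent-sym x~w) (path-from x≢vout ++ base))
  ... | _ | _ | _ = base

  module _ (a : Vector ℚ n) where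

    ·-trace-excursion : ∀ {x w} → x ≢ vout → w ≢ vout → Adj G x w →
                        a · trace (walk (excursion x w)) ≡ a x + a w + a · trace (walk (loop x))
    ·-trace-excursion {x} {w} x≢vout w≢vout x~w with x Fin.≟ vout | w Fin.≟ vout | adjacent? x w
    ... | yes x≡vout | _          | _        = contradiction x≡vout x≢vout
    ... | no _       | yes w≡vout | _        = contradiction w≡vout w≢vout
    ... | no _       | no _       | no ¬x~w  = contradiction x~w ¬x~w
    ... | no x≢vout′ | no w≢vout′ | yes x~w′ = begin
      a · trace (P ++ step x≢vout′ x~w′ R)
        ≡⟨ ·-trace-++ a P (step x≢vout′ x~w′ R) ⟩
      weight⁻ a P + a · trace (step x≢vout′ x~w′ R)
        ≡⟨ cong (weight⁻ a P +_) (trans (·-trace-step a x≢vout′ x~w′ R)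
                                        (cong (a x +_) (·-trace-step a w≢vout′ w~x Q))) ⟩
      weight⁻ a P + (a x + (a w + a · trace Q))
        ≡⟨ solve 4 (λ p x w q → p :+ (x :+ (w :+ q)) := x :+ w :+ (p :+ q)) refl
                   (weight⁻ a P) (a x) (a w) (a · trace Q) ⟩
      a x + a w + (weight⁻ a P + a · trace Q)
        ≡⟨ cong (a x + a w +_) (·-trace-++ a P Q) ⟨
      a x + a w + a · trace (P ++ Q) ∎
      where
      P = path-to x≢vout′
      Q = path-from x≢vout′ ++ base
      w~x = adjacent-sym x~w′
      R = step w≢vout′ w~x Q

    ·-trace-exit : ∀ {z} → z ≢ vout → Adj G z vout →
                   ∃ λ (P : WalkAvoid G vout vin z) →
                     a · trace (walk (excursion z vout)) ≡ weight⁻ a P + (a z + a vout)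
    ·-trace-exit {z} z≢vout z~vout with z Fin.≟ vout | vout Fin.≟ vout | adjacent? z vout
    ... | yes z≡vout | _        | _           = contradiction z≡vout z≢vout
    ... | no _       | no ¬refl  | _           = contradiction refl ¬refl
    ... | no _       | yes _    | no ¬z~vout  = contradiction z~vout ¬z~vout
    ... | no z≢vout′ | yes refl | yes z~vout′ = P , (begin
      a · trace (P ++ E)
        ≡⟨ ·-trace-++ a P E ⟩
      weight⁻ a P + a · trace E
        ≡⟨ cong (weight⁻ a P +_) (trans (·-trace-step a z≢vout′ z~vout′ stop) (cong (a z +_) (·-δ a vout))) ⟩
      weight⁻ a P + (a z + a vout) ∎)
      where
      P = path-to z≢vout′
      E : PWalk G vout z
      E = step z≢vout′ z~vout′ stop

  module Annihilator (y : Vector ℚ (suc n)) (y⊥probes : ∀ p → y · lift (trace (walk p)) ≡ 0ℚ) where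

    c : ℚ
    c = y zero

    a : Vector ℚ n
    a = tail y

    balanced : ∀ p → c + a · trace (walk p) ≡ 0ℚ
    balanced p = trans (cong (_+ a · trace (walk p)) (sym (*-identityʳ c))) (y⊥probes p)

    edge-antisymmetric : ∀ {x w} → x ≢ vout → w ≢ vout → Adj G x w → a x + a w ≡ 0ℚ
    edge-antisymmetric {x} {w} x≢vout w≢vout x~w = begin
      a x + a w
        ≡⟨ solve 4 (λ c x w l → x :+ w := (c :+ (x :+ w :+ l)) :- (c :+ l)) refl c (a x) (a w) L ⟩
      (c + (a x + a w + L)) - (c + L)
        ≡⟨ cong₂ _-_ excursion-balanced (balanced (loop x)) ⟩
      0ℚ - 0ℚ ≡⟨⟩
      0ℚ ∎
      where
      L = a · trace (walk (loop x))
      excursion-balanced : c + (a x + a w + L) ≡ 0ℚ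
      excursion-balanced =
        trans (cong (c +_) (sym (·-trace-excursion a x≢vout w≢vout x~w))) (balanced (excursion x w))

    edge-negates : ∀ {x w} → x ≢ vout → w ≢ vout → Adj G x w → a w ≡ - a x
    edge-negates {x} {w} x≢vout w≢vout x~w = begin
      a w                ≡⟨ solve 2 (λ x w → w := (x :+ w) :- x) refl (a x) (a w) ⟩
      (a x + a w) - a x  ≡⟨ cong (_- a x) (edge-antisymmetric x≢vout w≢vout x~w) ⟩
      0ℚ - a x           ≡⟨ +-identityˡ (- a x) ⟩
      - a x              ∎

    telescope : ∀ {u v} (W : WalkAvoid G vout u v) → weight⁻ a W + weight⁻ a W + a v ≡ a u
    telescope {u} (here _) = +-identityˡ (a u)
    telescope {u} {v} (step {w = w} u≢vout u~w W) = begin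
      (a u + S) + (a u + S) + a v
        ≡⟨ solve 3 (λ x s v → (x :+ s) :+ (x :+ s) :+ v := (s :+ s :+ v) :+ (x :+ x)) refl (a u) S (a v) ⟩
      (S + S + a v) + (a u + a u)
        ≡⟨ cong (_+ (a u + a u)) (telescope W) ⟩
      a w + (a u + a u)
        ≡⟨ solve 2 (λ x w → w :+ (x :+ x) := (x :+ w) :+ x) refl (a u) (a w) ⟩
      (a u + a w) + a u
        ≡⟨ cong (_+ a u) (edge-antisymmetric u≢vout (start≢ W) u~w) ⟩
      0ℚ + a u
        ≡⟨ +-identityˡ (a u) ⟩
      a u ∎
      where
      S = weight⁻ a W

    exit-equation : ∀ {z} → z ≢ vout → Adj G z vout → (c + a vout) + (c + a vout) + (a vin + a z) ≡ 0ℚ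
    exit-equation {z} z≢vout z~vout =
      let P , exit = ·-trace-exit a z≢vout z~vout
          p = weight⁻ a P
          E = c + (p + (a z + a vout))
      in begin
      (c + a vout) + (c + a vout) + (a vin + a z)
        ≡⟨ solve 5 (λ c v i z p → (c :+ v) :+ (c :+ v) :+ (i :+ z)
                                  := (c :+ (p :+ (z :+ v))) :+ (c :+ (p :+ (z :+ v))) :+ (i :- (p :+ p :+ z)))
                   refl c (a vout) (a vin) (a z) p ⟩
      E + E + (a vin - (p + p + a z))
        ≡⟨ cong₂ (λ e t → e + e + (a vin - t))
                 (trans (cong (c +_) (sym exit)) (balanced (excursion z vout))) (telescope P) ⟩
      0ℚ + 0ℚ + (a vin - a vin)
        ≡⟨ solve 1 (λ i → con 0ℚ :+ con 0ℚ :+ (i :- i) := con 0ℚ) refl (a vin) ⟩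
      0ℚ ∎

    exits-agree : ∀ {z} → z ≢ vout → Adj G z vout → a z ≡ a z₀
    exits-agree {z} z≢vout z~vout = begin
      a z
        ≡⟨ solve 4 (λ s i z w → z := w :+ ((s :+ (i :+ z)) :- (s :+ (i :+ w)))) refl s (a vin) (a z) (a z₀) ⟩
      a z₀ + (E z - E z₀)
        ≡⟨ cong₂ (λ p q → a z₀ + (p - q)) (exit-equation z≢vout z~vout) (exit-equation z₀≢vout z₀~vout) ⟩
      a z₀ + (0ℚ - 0ℚ)
        ≡⟨ +-identityʳ (a z₀) ⟩
      a z₀ ∎
      where
      s = (c + a vout) + (c + a vout)
      E : Fin n → ℚ
      E x = s + (a vin + a x)

    ±-along : ∀ {u v} (W : WalkAvoid G vout u v) → a v ≡ a u ⊎ a v ≡ - a u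
    ±-along (here _) = inj₁ refl
    ±-along (step {u = u} {w} u≢vout u~w W) =
      [ (λ av≡aw → inj₂ (trans av≡aw aw≡-au)) , (λ av≡-aw → inj₁ (trans av≡-aw -aw≡au)) ]′ (±-along W)
      where
      aw≡-au : a w ≡ - a u
      aw≡-au = edge-negates u≢vout (start≢ W) u~w
      -aw≡au : - a w ≡ a u
      -aw≡au = trans (cong -_ aw≡-au) (solve 1 (λ x → :- (:- x) := x) refl (a u))

    a[vin]≢0⇒bipartite : a vin ≢ 0ℚ → Bipartite G
    a[vin]≢0⇒bipartite a[vin]≢0 = colour , proper
      where
      like-vin : Fin n → Bool
      like-vin x = isYes (a x ≟ a vin)

      colour-at : (x : Fin n) → Dec (x ≡ vout) → Bool
      colour-at _ (yes _) = Bool.not (like-vin z₀)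
      colour-at x (no _)  = like-vin x

      colour : Fin n → Bool
      colour x = colour-at x (x Fin.≟ vout)

      unlike⇒opposite : ∀ {x} → x ≢ vout → a x ≢ a vin → a x ≡ - a vin
      unlike⇒opposite x≢vout ax≢a[vin] with ±-along (path-to x≢vout)
      ... | inj₁ ax≡a[vin]  = contradiction ax≡a[vin] ax≢a[vin]
      ... | inj₂ ax≡-a[vin] = ax≡-a[vin]

      proper-off-vout : ∀ {u v} → u ≢ vout → v ≢ vout → Adj G u v → like-vin u ≢ like-vin v
      proper-off-vout {u} {v} u≢vout v≢vout u~v with a u ≟ a vin | a v ≟ a vin
      ... | yes au≡a[vin] | yes av≡a[vin] = λ _ → a[vin]≢0 (halve (begin
        a vin + a vin  ≡⟨ cong₂ _+_ au≡a[vin] av≡a[vin] ⟨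
        a u + a v      ≡⟨ edge-antisymmetric u≢vout v≢vout u~v ⟩
        0ℚ             ∎))
      ... | yes _ | no _  = λ ()
      ... | no _  | yes _ = λ ()
      ... | no au≢a[vin] | no av≢a[vin] = λ _ → a[vin]≢0 (neg-injective {q = 0ℚ} (halve (begin
        - a vin + - a vin
          ≡⟨ cong₂ _+_ (unlike⇒opposite u≢vout au≢a[vin]) (unlike⇒opposite v≢vout av≢a[vin]) ⟨
        a u + a v
          ≡⟨ edge-antisymmetric u≢vout v≢vout u~v ⟩
        0ℚ ∎)))

      exit-like-z₀ : ∀ {z} → z ≢ vout → Adj G z vout → like-vin z ≡ like-vin z₀
      exit-like-z₀ z≢vout z~vout = cong (λ q → isYes (q ≟ a vin)) (exits-agree z≢vout z~vout)

      proper : ∀ u v → Adj G u v → colour u ≢ colour v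
      proper u v u~v with u Fin.≟ vout | v Fin.≟ vout
      ... | yes refl  | yes refl  = contradiction (trans (sym (irrefl G u)) u~v) λ ()
      ... | yes refl  | no v≢vout = Bool.not-¬ (exit-like-z₀ v≢vout (adjacent-sym u~v)) ∘ sym
      ... | no u≢vout | yes refl  = Bool.not-¬ (exit-like-z₀ u≢vout u~v)
      ... | no u≢vout | no v≢vout = proper-off-vout u≢vout v≢vout u~v

    module _ (¬bipartite : ¬ Bipartite G) where

      a[vin]≡0 : a vin ≡ 0ℚ
      a[vin]≡0 = decidable-stable (a vin ≟ 0ℚ) (¬bipartite ∘ a[vin]≢0⇒bipartite)

      a-off-vout≡0 : ∀ {x} → x ≢ vout → a x ≡ 0ℚ
      a-off-vout≡0 x≢vout with ±-along (path-to x≢vout)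
      ... | inj₁ ax≡a[vin]  = trans ax≡a[vin] a[vin]≡0
      ... | inj₂ ax≡-a[vin] = trans ax≡-a[vin] (cong -_ a[vin]≡0)

      c+a[vout]≡0 : c + a vout ≡ 0ℚ
      c+a[vout]≡0 = halve (begin
        (c + a vout) + (c + a vout)
          ≡⟨ +-identityʳ _ ⟨
        (c + a vout) + (c + a vout) + 0ℚ
          ≡⟨ cong ((c + a vout) + (c + a vout) +_) (cong₂ _+_ a[vin]≡0 (a-off-vout≡0 z₀≢vout)) ⟨
        (c + a vout) + (c + a vout) + (a vin + a z₀)
          ≡⟨ exit-equation z₀≢vout z₀~vout ⟩
        0ℚ ∎)

      nonbipartite-y∈Span : y ∈Span (vout-functional ∷ [])
      nonbipartite-y∈Span = (a vout ∷ []) , coordinates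
        where
        coordinates : ∀ t → y t ≡ combination (a vout ∷ []) (vout-functional ∷ []) t
        coordinates zero = begin
          c                          ≡⟨ solve 2 (λ c v → c := (c :+ v) :- v) refl c (a vout) ⟩
          (c + a vout) - a vout      ≡⟨ cong (_- a vout) c+a[vout]≡0 ⟩
          0ℚ - a vout                ≡⟨ solve 1 (λ v → con 0ℚ :- v := v :* con (- 1ℚ) :+ con 0ℚ) refl (a vout) ⟩
          a vout * - 1ℚ + 0ℚ         ∎
        coordinates (suc x) with x Fin.≟ vout
        ... | yes refl = begin
          a vout                     ≡⟨ solve 1 (λ v → v := v :* con 1ℚ :+ con 0ℚ) refl (a vout) ⟩
          a vout * 1ℚ + 0ℚ           ≡⟨ cong (λ d → a vout * d + 0ℚ) (δ-self vout) ⟨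
          a vout * δ vout vout + 0ℚ  ∎
        ... | no x≢vout = begin
          a x                        ≡⟨ a-off-vout≡0 x≢vout ⟩
          0ℚ                         ≡⟨ solve 1 (λ v → con 0ℚ := v :* con 0ℚ :+ con 0ℚ) refl (a vout) ⟩
          a vout * 0ℚ + 0ℚ           ≡⟨ cong (λ d → a vout * d + 0ℚ) (δ-≢ (x≢vout ∘ sym)) ⟨
          a vout * δ vout x + 0ℚ     ∎

    module _ (col : Fin n → Bool) (proper : ∀ u v → Adj G u v → col u ≢ col v) where
      open Signs G vout col proper using (s; s-alternates; sign-functional)

      s²* : ∀ x q → s x * s x * q ≡ q
      s²* x q = trans (cong (_* q) (sign²≡1 (col x))) (*-identityˡ q)

      signed-along : ∀ {u v} (W : WalkAvoid G vout u v) → s v * a v ≡ s u * a u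
      signed-along (here _) = refl
      signed-along {u} {v} (step {w = w} u≢vout u~w W) = begin
        s v * a v      ≡⟨ signed-along W ⟩
        s w * a w      ≡⟨ cong₂ _*_ (s-alternates u~w) (edge-negates u≢vout (start≢ W) u~w) ⟩
        - s u * - a u  ≡⟨ solve 2 (λ s a → :- s :* :- a := s :* a) refl (s u) (a u) ⟩
        s u * a u      ∎

      a-off-vout : ∀ {x} → x ≢ vout → a x ≡ s x * s vin * a vin
      a-off-vout {x} x≢vout = begin
        a x                    ≡⟨ s²* x (a x) ⟨
        s x * s x * a x        ≡⟨ *-assoc (s x) (s x) (a x) ⟩
        s x * (s x * a x)      ≡⟨ cong (s x *_) (signed-along (path-to x≢vout)) ⟩
        s x * (s vin * a vin)  ≡⟨ *-assoc (s x) (s vin) (a vin) ⟨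
        s x * s vin * a vin    ∎

      bipartite-y∈Span : y ∈Span (vout-functional ∷ sign-functional vin ∷ [])
      bipartite-y∈Span = (α ∷ β ∷ []) , coordinates
        where
        α β : ℚ
        α = a vout - s vout * s vin * a vin
        β = s vin * a vin
        coordinates : ∀ t → y t ≡ combination (α ∷ β ∷ []) (vout-functional ∷ sign-functional vin ∷ []) t
        coordinates zero = begin
          c
            ≡⟨ solve 4 (λ c v i z → c := (:- v :- con ½ :* (i :+ z)) :+ con ½ :* ((c :+ v) :+ (c :+ v) :+ (i :+ z)))
                       refl c (a vout) (a vin) (a z₀) ⟩
          (- a vout - ½ * (a vin + a z₀)) + ½ * ((c + a vout) + (c + a vout) + (a vin + a z₀))
            ≡⟨ cong₂ (λ z e → (- a vout - ½ * (a vin + z)) + ½ * e)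
                     (a-off-vout z₀≢vout) (exit-equation z₀≢vout z₀~vout) ⟩
          (- a vout - ½ * (a vin + s z₀ * s vin * a vin)) + ½ * 0ℚ
            ≡⟨ cong₂ (λ i z → (- a vout - ½ * (i + z * s vin * a vin)) + ½ * 0ℚ)
                     (sym (s²* vin (a vin))) (sign-flip (proper vout z₀ (adjacent-sym z₀~vout))) ⟩
          (- a vout - ½ * (s vin * s vin * a vin + - s vout * s vin * a vin)) + ½ * 0ℚ
            ≡⟨ solve 4 (λ v i p q → (:- v :- con ½ :* (p :* p :* i :+ :- q :* p :* i)) :+ con ½ :* con 0ℚ
                                    := (v :- q :* p :* i) :* con (- 1ℚ) :+ (p :* i :* (:- (con ½ :* (p :+ q))) :+ con 0ℚ))
                       refl (a vout) (a vin) (s vin) (s vout) ⟩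
          α * - 1ℚ + (β * - (½ * (s vin + s vout)) + 0ℚ) ∎
        coordinates (suc x) with x Fin.≟ vout
        ... | yes refl = begin
          a vout
            ≡⟨ solve 4 (λ v i p q → v := (v :- q :* p :* i) :* con 1ℚ :+ (p :* i :* q :+ con 0ℚ))
                       refl (a vout) (a vin) (s vin) (s vout) ⟩
          α * 1ℚ + (β * s vout + 0ℚ)
            ≡⟨ cong (λ d → α * d + (β * s vout + 0ℚ)) (δ-self vout) ⟨
          α * δ vout vout + (β * s vout + 0ℚ) ∎
        ... | no x≢vout = begin
          a x
            ≡⟨ a-off-vout x≢vout ⟩
          s x * s vin * a vin
            ≡⟨ solve 4 (λ α i p q → q :* p :* i := α :* con 0ℚ :+ (p :* i :* q :+ con 0ℚ))
                       refl α (a vin) (s vin) (s x) ⟩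
          α * 0ℚ + (β * s x + 0ℚ)
            ≡⟨ cong (λ d → α * d + (β * s x + 0ℚ)) (δ-≢ (x≢vout ∘ sym)) ⟨
          α * δ vout x + (β * s x + 0ℚ) ∎

  affinelyIndependent-probes :
    (b : Fin m → Vector ℚ (suc n)) → (∀ y → (∀ p → y · lift (trace (walk p)) ≡ 0ℚ) → y ∈Span b) →
    m ℕ.+ k ≡ suc n → Σ (Fin k → PWalk G vout vin) λ ω → AffinelyIndependent k (trace ∘ ω)
  affinelyIndependent-probes b annihilator∈b m+k≡1+n =
    let f , independent =
          independent-of-small-annihilator searchable-Probe (lift ∘ trace ∘ walk) b annihilator∈b m+k≡1+n
    in walk ∘ f , independent⇒affinelyIndependent independent

lemma2 : (n : ℕ) (G : Graph n) (vin vout : Fin n) → vin ≢ vout →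
         Connected G → ConnectedWithout G vout →
         ((¬ Bipartite G → AffHullDim (traces G vin vout) (n ∸ 1))
          × (Bipartite G → AffHullDim (traces G vin vout) (n ∸ 2)))
lemma2 (suc zero) G zero zero vin≢vout _ _ = contradiction refl vin≢vout
lemma2 (suc (suc m)) G vin vout vin≢vout G-connected G-vout-connected =
    (λ ¬bipartite →
        affinelyIndependent-probes (vout-functional ∷ [])
          (λ y y⊥ → Annihilator.nonbipartite-y∈Span y y⊥ ¬bipartite) refl
      , λ ω independent → ℕ.1+n≰n (affinelyIndependent-traces⇒≤ G {ω = ω} independent))
  , (λ { (col , proper) →
        affinelyIndependent-probes (vout-functional ∷ Signs.sign-functional G vout col proper vin ∷ [])
          (λ y y⊥ → Annihilator.bipartite-y∈Span y y⊥ col proper) refl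
      , λ ω independent →
          ℕ.1+n≰n (bipartite-affinelyIndependent-traces⇒≤ G vin≢vout (col , proper) {ω = ω} independent) })
  where
  open Walks G vout using (vout-functional; neighbour-of-vout)
  exit : ∃ λ z → z ≢ vout × Adj G z vout
  exit = neighbour-of-vout (G-connected vin vout) vin≢vout
  open Probes G vin≢vout G-vout-connected (proj₁ (proj₂ exit)) (proj₂ (proj₂ exit))
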